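{- Let $n\geqslant 15$ be an integer and $m$ an integer with $2n-1\leqslant m\leqslant 2.4n$, and suppose the numbers $k(k-1)$ $(1\leqslant k\leqslant n)$ are pairwise distinct modulo $m$. Then $m\neq 2p$ for every odd prime $p$. -}

module Defs where

module Submission where

-- Suppose m = 2p with p = 2q + 1 an odd prime.  The map
-- k ↦ p + 1 − k is a "reflection" of the residues of k(k − 1) modulo 2p:
-- writing j = c + 1 and k = c + 1 + 2d with c + d = q (so j + k = p + 1),
--     k(k − 1) = j(j − 1) + d · 2p,
-- hence k(k − 1) ≡ j(j − 1) (mod 2p) although k ≠ j as soon as d ≥ 1.
-- The bounds on m place n in the window q + 2 ≤ n ≤ p: the upper bound
-- 2n − 1 ≤ 2p gives n ≤ p, and 5m ≤ 12n with n ≥ 15 gives n ≥ q + 2.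
-- In that window k = n and j = p + 1 − n are two distinct indices in [1, n]
-- with the same residue, contradicting the distinctness hypothesis.

open import Defs
open import Data.Nat using (ℕ; suc; _+_; _*_; _∸_; _≤_; _%_; NonZero)
open import Data.Nat.Primality using (Prime)
open import Relation.Binary.PropositionalEquality using (_≡_; _≢_)

open import Data.Nat using (zero; _<_; z≤n; s≤s)
open import Data.Nat.Properties
open import Data.Nat.DivMod using ([m+kn]%n≡m%n)
open import Data.Nat.Divisibility using (divides)
open import Data.Nat.Primality using (prime⇒irreducible)
open import Data.Nat.Tactic.RingSolver using (solve-∀)
open import Data.Product using (∃; ∃₂; _×_; _,_)
open import Data.Sum using (_⊎_; inj₁; inj₂)
open import Data.Empty using (⊥-elim)
open import Relation.Binary.PropositionalEquality using (refl; sym; trans; cong; subst; module ≡-Reasoning)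

even-or-odd : ∀ p → (∃ λ q → p ≡ 2 * q) ⊎ (∃ λ q → p ≡ suc (2 * q))
even-or-odd zero = inj₁ (0 , refl)
even-or-odd (suc p) with even-or-odd p
... | inj₁ (q , p≡2q)   = inj₂ (q , cong suc p≡2q)
... | inj₂ (q , p≡2q+1) = inj₁ (suc q , trans (cong suc p≡2q+1) (2+2q q))
  where
  2+2q : ∀ q → suc (suc (2 * q)) ≡ 2 * suc q
  2+2q = solve-∀

odd-prime : ∀ p → Prime p → p ≢ 2 → ∃ λ q → p ≡ suc (2 * q)
odd-prime p p-prime p≢2 with even-or-odd p
... | inj₂ odd = odd
... | inj₁ (q , p≡2q) with prime⇒irreducible p-prime (divides q (trans p≡2q (*-comm 2 q)))
...   | inj₁ ()
...   | inj₂ 2≡p = ⊥-elim (p≢2 (sym 2≡p))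

-- The reflection identity: for k = (c + 1) + 2d and j = c + 1 (so that
-- j + k = 2(c + d) + 2), the products k(k − 1) and j(j − 1) differ by
-- d times the even modulus 2(2(c + d) + 1).
reflection-identity : ∀ c d →
  (suc c + 2 * d) * (c + 2 * d) ≡ suc c * c + d * (2 * suc (2 * (c + d)))
reflection-identity = solve-∀

reflection-collision : ∀ c d → let k = suc c + 2 * d ; M = 2 * suc (2 * (c + d)) in
  (k * (k ∸ 1)) % M ≡ (suc c * (suc c ∸ 1)) % M
reflection-collision c d = begin
  ((suc c + 2 * d) * (c + 2 * d)) % M     ≡⟨ cong (_% M) (reflection-identity c d) ⟩
  (suc c * c + d * M) % M                 ≡⟨ [m+kn]%n≡m%n (suc c * c) d M ⟩
  (suc c * c) % M                         ∎
  where
  M = 2 * suc (2 * (c + d))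
  open ≡-Reasoning

halve-bound : ∀ n p → 2 * n ∸ 1 ≤ 2 * p → n ≤ p
halve-bound n p 2n-1≤2p = ≤-pred (*-cancelˡ-< 2 n (suc p) 2n<2p+2)
  where
  2n<2p+2 : 2 * n < 2 * suc p
  2n<2p+2 = begin-strict
    2 * n             ≤⟨ m≤n+m∸n (2 * n) 1 ⟩
    suc (2 * n ∸ 1)   ≤⟨ s≤s 2n-1≤2p ⟩
    suc (2 * p)       <⟨ n<1+n (suc (2 * p)) ⟩
    suc (suc (2 * p)) ≡⟨ cong suc (sym (+-suc p (p + 0))) ⟩
    2 * suc p         ∎
    where open ≤-Reasoning

-- Lower end of the window: for p = 2q + 1, the bound 5 · 2p ≤ 12n together
-- with n ≥ 15 forces q + 2 ≤ n.  For q ≥ 1 this is 12(q + 1) < 10p ≤ 12n;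
-- for q = 0 it follows from n ≥ 15.
twelve-fifths-bound : ∀ n q → 15 ≤ n → 5 * (2 * suc (2 * q)) ≤ 12 * n → suc (suc q) ≤ n
twelve-fifths-bound n zero    15≤n _     = ≤-trans (s≤s (s≤s z≤n)) 15≤n
twelve-fifths-bound n (suc r) _    10p≤12n =
  *-cancelˡ-< 12 (suc (suc r)) n (<-≤-trans 12q+12<10p 10p≤12n)
  where
  10p-as-sum : ∀ r → 5 * (2 * suc (2 * suc r)) ≡ suc (12 * suc (suc r)) + (5 + 8 * r)
  10p-as-sum = solve-∀
  12q+12<10p : 12 * suc (suc r) < 5 * (2 * suc (2 * suc r))
  12q+12<10p = subst (suc (12 * suc (suc r)) ≤_) (sym (10p-as-sum r))
                 (m≤m+n (suc (12 * suc (suc r))) (5 + 8 * r))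

window-decomposition : ∀ n q → suc (suc q) ≤ n → n ≤ suc (2 * q) →
  ∃₂ λ c d → n ≡ suc c + 2 * suc d × q ≡ c + suc d
window-decomposition n q q+2≤n n≤p
  with m≤n⇒∃[o]m+o≡n q+2≤n | m≤n⇒∃[o]m+o≡n n≤p
... | d , refl | c , n+c≡p = c , d , n≡ , q≡
  where
  shift : ∀ q c d → suc (suc q) + d + c ≡ q + suc (suc (c + d))
  shift = solve-∀
  double : ∀ q → suc (2 * q) ≡ q + suc q
  double = solve-∀
  -- (q + 2 + d) + c = 2q + 1; cancelling q leaves q + 1 = c + d + 2.
  q≡ : q ≡ c + suc d
  q≡ = sym (trans (+-suc c d) (suc-injective (+-cancelˡ-≡ q _ _
         (trans (sym (shift q c d)) (trans n+c≡p (double q))))))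
  n≡ : suc (suc q) + d ≡ suc c + 2 * suc d
  n≡ = begin
    suc (suc q) + d               ≡⟨ cong (λ x → suc (suc x) + d) q≡ ⟩
    suc (suc (c + suc d)) + d     ≡⟨ reshape c d ⟩
    suc c + 2 * suc d             ∎
    where
    reshape : ∀ c d → suc (suc (c + suc d)) + d ≡ suc c + 2 * suc d
    reshape = solve-∀
    open ≡-Reasoning

lemma2p1 : (n m : ℕ) → .{{_ : NonZero m}} → 15 ≤ n → 2 * n ∸ 1 ≤ m → 5 * m ≤ 12 * n
    → (∀ i j → 1 ≤ i → i ≤ n → 1 ≤ j → j ≤ n → (i * (i ∸ 1)) % m ≡ (j * (j ∸ 1)) % m → i ≡ j)
    → ∀ p → Prime p → p ≢ 2 → m ≢ 2 * p
lemma2p1 n m 15≤n lower upper distinct p p-prime p≢2 refl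
  with odd-prime p p-prime p≢2
... | q , refl
  with window-decomposition n q (twelve-fifths-bound n q 15≤n upper) (halve-bound n p lower)
... | c , d , refl , refl =
  m+1+n≢m c (suc-injective (distinct n (suc c) (s≤s z≤n) ≤-refl (s≤s z≤n) j≤n (reflection-collision c (suc d))))
  where
  j≤n : suc c ≤ suc c + 2 * suc d
  j≤n = m≤m+n (suc c) (2 * suc d)
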